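{- For every $n\ge 1$ there is a bijection between the set of atomic cohorts of arch systems with $n$ arches and the set of objects of size $n$ in the combinatorial class $\mathcal{A}$ defined below; that is, there is a size-preserving bijection between atomic cohorts and $\mathcal{A}$.
   Context: An arch system of size $n$ is a set of $n$ non-crossing arches above a baseline connecting $2n$ points, each point an endpoint of exactly one arch; the empty system has size $0$. Concatenation $AB$ places $B$ right of $A$. An atom is a non-empty arch system that is not a concatenation of two non-empty ones; every atom is $\langle A\rangle$, obtained from its contents $A$ by adding one enclosing arch. The relation $\sim$ is the finest equivalence relation on arch systems such that for all arch systems $A,B,P,Q$ and all $a,b,c$ each an atom or empty: (R1) $A\sim B\Rightarrow\langle A\rangle\sim\langle B\rangle$; (R2) $a\sim b\Rightarrow PaQ\sim PbQ$; (R3) $PabQ\sim PbaQ$; (R4) $a\langle bc\rangle\sim\langle ab\rangle c$. Its equivalence classes are called cohorts; the size of a cohort is the common number of arches of its elements. A cohort is atomic if it contains at least one atom. The classes $\mathcal{A}$ and $\mathcal{B}$ of non-plane tree-like structures are defined by the mutually recursive specification $\mathcal{A} = \bullet \uplus (\bullet,\mathcal{A}) \uplus \biguplus_{k\ge 2} (\triangle_{k-1}, \mathrm{MSet}_k(\mathcal{B})) \uplus \mathcal{B}$ and $\mathcal{B} = (\bullet, \mathrm{MSet}_{\ge 3}(\mathcal{A}))$, where $\bullet$ is a class with a single object of size $1$, $\triangle_m$ is a class with a single object of size $m$, parentheses denote ordered pairs (size = sum of sizes), $\uplus$ is disjoint union, and $\mathrm{MSet}_k$ (resp. $\mathrm{MSet}_{\ge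 3}$) denotes multisets with exactly $k$ (resp. at least $3$) elements, size being the sum of sizes of the elements. -}

module Defs where

open import Data.Nat using (ℕ; zero; suc; _+_; _∸_; _≤_)
open import Data.List using (List; []; _∷_; _++_; length)
open import Data.Maybe using (Maybe; just; nothing)
open import Data.Product using (Σ; _×_; _,_; proj₁; ∃-syntax)
open import Relation.Binary.PropositionalEquality using (_≡_)
open import Relation.Binary.Bundles using (Setoid)
open import Level using (0ℓ)

data Atom : Set where
  ⟨_⟩ : List Atom → Atom

ArchSystem : Set
ArchSystem = List Atom

mutual
  -- number of arches
  atomSize : Atom → ℕ
  atomSize ⟨ A ⟩ = suc (size A)

  size : ArchSystem → ℕ
  size [] = 0
  size (a ∷ A) = atomSize a + size A

AtomOrEmpty : Set
AtomOrEmpty = Maybe Atom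

sys : AtomOrEmpty → ArchSystem
sys nothing = []
sys (just a) = a ∷ []

atom : Atom → ArchSystem
atom a = a ∷ []

infix 4 _∼_
data _∼_ : ArchSystem → ArchSystem → Set where
  ∼-refl  : ∀ {A} → A ∼ A
  ∼-sym   : ∀ {A B} → A ∼ B → B ∼ A
  ∼-trans : ∀ {A B C} → A ∼ B → B ∼ C → A ∼ C
  R1 : ∀ {A B} → A ∼ B → atom ⟨ A ⟩ ∼ atom ⟨ B ⟩
  R2 : ∀ (P Q : ArchSystem) {a b : AtomOrEmpty} → sys a ∼ sys b →
       P ++ sys a ++ Q ∼ P ++ sys b ++ Q
  R3 : ∀ (P Q : ArchSystem) (a b : AtomOrEmpty) →
       P ++ sys a ++ sys b ++ Q ∼ P ++ sys b ++ sys a ++ Q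
  R4 : ∀ (a b c : AtomOrEmpty) →
       sys a ++ atom ⟨ sys b ++ sys c ⟩ ∼ atom ⟨ sys a ++ sys b ⟩ ++ sys c

-- Atomic cohorts of size n, as a setoid: elements are arch systems with
-- n arches whose cohort contains an atom; equality is ∼ (so the
-- equivalence classes of this setoid are exactly the atomic cohorts of
-- size n).
AtomicCohorts : ℕ → Setoid 0ℓ 0ℓ
AtomicCohorts n = record
  { Carrier = Σ ArchSystem (λ S → size S ≡ n × ∃[ t ] (atom t ∼ S))
  ; _≈_ = λ x y → proj₁ x ∼ proj₁ y
  ; isEquivalence = record { refl = ∼-refl ; sym = ∼-sym ; trans = ∼-trans }
  }

-- The classes 𝒜 and ℬ (non-plane: multisets are lists up to
-- rearrangement, see the equivalence _≈A_ below).
--   𝒜 = • ⊎ (•,𝒜) ⊎ ⊎_{k≥2} (△_{k-1}, MSet_k ℬ) ⊎ ℬ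
--   ℬ = (•, MSet_{≥3} 𝒜)

mutual
  data 𝒜 : Set where
    dot  : 𝒜
    pin  : 𝒜 → 𝒜
    tri  : (bs : List ℬ) → 2 ≤ length bs → 𝒜   -- (△_{k-1}, MSet_k ℬ), k = length bs
    b→a  : ℬ → 𝒜

  data ℬ : Set where
    node : (as : List 𝒜) → 3 ≤ length as → ℬ

mutual
  sizeA : 𝒜 → ℕ
  sizeA dot = 1
  sizeA (pin x) = 1 + sizeA x
  sizeA (tri bs _) = (length bs ∸ 1) + sizeLB bs
  sizeA (b→a b) = sizeB b

  sizeB : ℬ → ℕ
  sizeB (node as _) = 1 + sizeLA as

  sizeLA : List 𝒜 → ℕ
  sizeLA [] = 0
  sizeLA (x ∷ xs) = sizeA x + sizeLA xs

  sizeLB : List ℬ → ℕ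
  sizeLB [] = 0
  sizeLB (x ∷ xs) = sizeB x + sizeLB xs

-- Equality of objects of 𝒜/ℬ: isomorphism, i.e. the equivalence
-- generated by componentwise congruence and rearranging the elements of
-- the multisets (lists up to permutation, elementwise up to ≈).
mutual
  data _≈A_ : 𝒜 → 𝒜 → Set where
    ≈A-refl  : ∀ {x} → x ≈A x
    ≈A-sym   : ∀ {x y} → x ≈A y → y ≈A x
    ≈A-trans : ∀ {x y z} → x ≈A y → y ≈A z → x ≈A z
    pin-cong : ∀ {x y} → x ≈A y → pin x ≈A pin y
    tri-cong : ∀ {bs cs p q} → bs ≈LB cs → tri bs p ≈A tri cs q
    b→a-cong : ∀ {b c} → b ≈B c → b→a b ≈A b→a c

  data _≈B_ : ℬ → ℬ → Set where
    node-cong : ∀ {as cs p q} → as ≈LA cs → node as p ≈B node cs q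

  data _≈LA_ : List 𝒜 → List 𝒜 → Set where
    []    : [] ≈LA []
    _∷_   : ∀ {x y xs ys} → x ≈A y → xs ≈LA ys → (x ∷ xs) ≈LA (y ∷ ys)
    swap  : ∀ {x y xs} → (x ∷ y ∷ xs) ≈LA (y ∷ x ∷ xs)
    trans : ∀ {xs ys zs} → xs ≈LA ys → ys ≈LA zs → xs ≈LA zs

  data _≈LB_ : List ℬ → List ℬ → Set where
    []    : [] ≈LB []
    _∷_   : ∀ {x y xs ys} → x ≈B y → xs ≈LB ys → (x ∷ xs) ≈LB (y ∷ ys)
    swap  : ∀ {x y xs} → (x ∷ y ∷ xs) ≈LB (y ∷ x ∷ xs)
    trans : ∀ {xs ys zs} → xs ≈LB ys → ys ≈LB zs → xs ≈LB zs

𝒜-of-size : ℕ → Setoid 0ℓ 0ℓ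
𝒜-of-size n = record
  { Carrier = Σ 𝒜 (λ x → sizeA x ≡ n)
  ; _≈_ = λ x y → proj₁ x ≈A proj₁ y
  ; isEquivalence = record { refl = ≈A-refl ; sym = ≈A-sym ; trans = ≈A-trans }
  }

-- Call an atom rigid when it has at least three children.  The profile of
-- an arch system is the multiset of its outermost rigid atoms, each read as
-- the object of ℬ formed by the objects of its children, together with the
-- number w of arches outside them.  Profiles are invariant under ∼: R4 only
-- moves arches enclosing at most two atoms, R3 only permutes, and a rigid
-- atom can only have its children permuted or replaced by equivalent ones.
-- An atom whose profile has k blocks goes to the object of 𝒜 given by
-- • (k = 0), the block (k = 1) or the △ₖ₋₁ of the blocks (k ≥ 2) under the
-- w - 1, w or w - (k - 1) surplus arches as pins.  Conversely every object
-- is realised by an explicit atom, and every atom is ∼ to the realisation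
-- of its own object: R4 pushes pins outwards and merges two combs of blocks
-- into one, and the size, which ∼ preserves, determines the number of pins.

module Submission where

open import Defs
open import Data.Empty using (⊥-elim)
open import Data.List using (List; []; _∷_; _++_; length)
open import Data.List.Properties using (length-++; ++-identityʳ; ++-assoc)
import Data.List.Relation.Binary.Permutation.Homogeneous as Homogeneous
import Data.List.Relation.Binary.Permutation.Setoid as Permutation
import Data.List.Relation.Binary.Permutation.Setoid.Properties as PermutationProperties
open import Data.List.Relation.Binary.Pointwise using (Pointwise; []; _∷_)
open import Data.Maybe using (just; nothing)
open import Data.Nat using (ℕ; zero; suc; _+_; _∸_; _≤_; _<_; _≤?_; z≤n; s≤s)
open import Data.Nat.Properties
  using (+-comm; +-assoc; +-suc; +-identityʳ; +-∸-assoc; m∸n+n≡m; n∸n≡0; +-cancelʳ-≡;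
         0≢1+n; <⇒≱; ≰⇒>; ≤-pred; ≤-trans; +-mono-≤; +-monoˡ-≤)
open import Data.Nat.Tactic.RingSolver using (solve-∀)
open import Data.Product using (_×_; _,_; proj₁; proj₂; ∃-syntax)
open import Function.Bundles using (Bijection)
open import Level using (0ℓ)
open import Relation.Binary.Bundles using (Setoid)
open import Relation.Binary.PropositionalEquality as ≡ using (_≡_; refl; cong; cong₂; subst; subst₂; module ≡-Reasoning)
import Relation.Binary.Reasoning.Setoid as SetoidReasoning
open import Relation.Nullary using (yes; no)

private
  variable
    x y : 𝒜
    b c : ℬ
    xs ys : List 𝒜
    bs cs : List ℬ

≈LA-refl : xs ≈LA xs
≈LA-refl {[]} = []
≈LA-refl {_ ∷ _} = ≈A-refl ∷ ≈LA-refl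

≈LA-sym : xs ≈LA ys → ys ≈LA xs
≈LA-sym [] = []
≈LA-sym (x≈y ∷ xs≈ys) = ≈A-sym x≈y ∷ ≈LA-sym xs≈ys
≈LA-sym swap = swap
≈LA-sym (trans p q) = trans (≈LA-sym q) (≈LA-sym p)

≈LA-length : xs ≈LA ys → length xs ≡ length ys
≈LA-length [] = refl
≈LA-length (_ ∷ xs≈ys) = cong suc (≈LA-length xs≈ys)
≈LA-length swap = refl
≈LA-length (trans p q) = ≡.trans (≈LA-length p) (≈LA-length q)

≈B-refl : b ≈B b
≈B-refl {node _ _} = node-cong ≈LA-refl

≈B-sym : b ≈B c → c ≈B b
≈B-sym (node-cong p) = node-cong (≈LA-sym p)

≈B-trans : ∀ {d} → b ≈B c → c ≈B d → b ≈B d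
≈B-trans (node-cong p) (node-cong q) = node-cong (trans p q)

≈B-setoid : Setoid 0ℓ 0ℓ
≈B-setoid = record
  { Carrier = ℬ
  ; _≈_ = _≈B_
  ; isEquivalence = record { refl = ≈B-refl ; sym = ≈B-sym ; trans = ≈B-trans }
  }

open Permutation ≈B-setoid using (_↭_; ↭-refl; ↭-sym; ↭-swap)
module ↭ = PermutationProperties ≈B-setoid

≈LB⇒↭ : bs ≈LB cs → bs ↭ cs
≈LB⇒↭ [] = ↭-refl
≈LB⇒↭ (b≈c ∷ p) = Homogeneous.prep b≈c (≈LB⇒↭ p)
≈LB⇒↭ swap = ↭-swap _ _ ↭-refl
≈LB⇒↭ (trans p q) = Homogeneous.trans (≈LB⇒↭ p) (≈LB⇒↭ q)

↭⇒≈LB : bs ↭ cs → bs ≈LB cs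
↭⇒≈LB (Homogeneous.refl p) = pointwise⇒≈LB p
  where
    pointwise⇒≈LB : Pointwise _≈B_ bs cs → bs ≈LB cs
    pointwise⇒≈LB [] = []
    pointwise⇒≈LB (b≈c ∷ p) = b≈c ∷ pointwise⇒≈LB p
↭⇒≈LB (Homogeneous.prep b≈c p) = b≈c ∷ ↭⇒≈LB p
↭⇒≈LB (Homogeneous.swap b≈b′ c≈c′ p) = trans swap (c≈c′ ∷ b≈b′ ∷ ↭⇒≈LB p)
↭⇒≈LB (Homogeneous.trans p q) = trans (↭⇒≈LB p) (↭⇒≈LB q)

≈LB-refl : bs ≈LB bs
≈LB-refl = ↭⇒≈LB ↭-refl

≈LB-sym : bs ≈LB cs → cs ≈LB bs
≈LB-sym p = ↭⇒≈LB (↭-sym (≈LB⇒↭ p))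

≈LB-length : bs ≈LB cs → length bs ≡ length cs
≈LB-length p = ↭.xs↭ys⇒|xs|≡|ys| (≈LB⇒↭ p)

≈LB-++⁺ : ∀ {bs′ cs′ : List ℬ} → bs ≈LB bs′ → cs ≈LB cs′ → (bs ++ cs) ≈LB (bs′ ++ cs′)
≈LB-++⁺ p q = ↭⇒≈LB (↭.++⁺ (≈LB⇒↭ p) (≈LB⇒↭ q))

≈LB-++-comm : ∀ bs cs → (bs ++ cs) ≈LB (cs ++ bs)
≈LB-++-comm bs cs = ↭⇒≈LB (↭.++-comm bs cs)

≈LB-++-assoc : ∀ bs cs ds → ((bs ++ cs) ++ ds) ≈LB (bs ++ (cs ++ ds))
≈LB-++-assoc bs cs ds = ↭⇒≈LB (↭.++-assoc bs cs ds)

-- Profiles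

infix 4 _∣_
record Profile : Set where
  constructor _∣_
  field
    blocks : List ℬ
    weight : ℕ

open Profile

private
  variable
    p q r : Profile

ε : Profile
ε = [] ∣ 0

infixl 6 _⊕_
_⊕_ : Profile → Profile → Profile
p ⊕ q = blocks p ++ blocks q ∣ weight p + weight q

addArch : Profile → Profile
addArch p = blocks p ∣ suc (weight p)

infix 4 _≈P_
_≈P_ : Profile → Profile → Set
p ≈P q = blocks p ≈LB blocks q × weight p ≡ weight q

≈P-refl : p ≈P p
≈P-refl = ≈LB-refl , refl

≈P-sym : p ≈P q → q ≈P p
≈P-sym (L≈ , w≡) = ≈LB-sym L≈ , ≡.sym w≡

≈P-trans : p ≈P q → q ≈P r → p ≈P r
≈P-trans (L≈ , w≡) (L≈′ , w≡′) = trans L≈ L≈′ , ≡.trans w≡ w≡′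

≈P-setoid : Setoid 0ℓ 0ℓ
≈P-setoid = record
  { Carrier = Profile
  ; _≈_ = _≈P_
  ; isEquivalence = record { refl = ≈P-refl ; sym = ≈P-sym ; trans = ≈P-trans }
  }

module ≈P-Reasoning = SetoidReasoning ≈P-setoid

⊕-cong : ∀ {p′ q′} → p ≈P p′ → q ≈P q′ → p ⊕ q ≈P p′ ⊕ q′
⊕-cong (L≈ , w≡) (L≈′ , w≡′) = ≈LB-++⁺ L≈ L≈′ , cong₂ _+_ w≡ w≡′

addArch-cong : p ≈P q → addArch p ≈P addArch q
addArch-cong (L≈ , w≡) = L≈ , cong suc w≡

⊕-identityʳ : ∀ p → p ⊕ ε ≡ p
⊕-identityʳ (L ∣ w) = cong₂ _∣_ (++-identityʳ L) (+-identityʳ w)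

⊕-assoc : ∀ p q r → (p ⊕ q) ⊕ r ≈P p ⊕ (q ⊕ r)
⊕-assoc p q r = ≈LB-++-assoc (blocks p) (blocks q) (blocks r) , +-assoc (weight p) (weight q) (weight r)

⊕-comm : ∀ p q → p ⊕ q ≈P q ⊕ p
⊕-comm p q = ≈LB-++-comm (blocks p) (blocks q) , +-comm (weight p) (weight q)

⊕-left-comm : ∀ p q r → p ⊕ (q ⊕ r) ≈P q ⊕ (p ⊕ r)
⊕-left-comm p q r =
  ≈P-trans (≈P-sym (⊕-assoc p q r)) (≈P-trans (⊕-cong (⊕-comm p q) (≈P-refl {r})) (⊕-assoc q p r))

⊕-addArchʳ : ∀ p q → p ⊕ addArch q ≡ addArch (p ⊕ q)
⊕-addArchʳ p q = cong (blocks p ++ blocks q ∣_) (+-suc (weight p) (weight q))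

profileSize : Profile → ℕ
profileSize p = sizeLB (blocks p) + weight p

sizeLB-++ : ∀ bs cs → sizeLB (bs ++ cs) ≡ sizeLB bs + sizeLB cs
sizeLB-++ [] cs = refl
sizeLB-++ (b ∷ bs) cs = ≡.trans (cong (sizeB b +_) (sizeLB-++ bs cs)) (≡.sym (+-assoc (sizeB b) _ _))

profileSize-⊕ : ∀ p q → profileSize (p ⊕ q) ≡ profileSize p + profileSize q
profileSize-⊕ (L ∣ w) (L′ ∣ w′) =
  ≡.trans (cong (_+ (w + w′)) (sizeLB-++ L L′)) (interchange (sizeLB L) (sizeLB L′) w w′)
  where
    interchange : ∀ a b c d → (a + b) + (c + d) ≡ (a + c) + (b + d)
    interchange = solve-∀

profileSize-addArch : ∀ p → profileSize (addArch p) ≡ suc (profileSize p)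
profileSize-addArch p = +-suc (sizeLB (blocks p)) (weight p)

pins : ℕ → 𝒜 → 𝒜
pins zero x = x
pins (suc k) x = pin (pins k x)

core : List ℬ → 𝒜
core [] = dot
core (b ∷ []) = b→a b
core (b ∷ b′ ∷ bs) = tri (b ∷ b′ ∷ bs) (s≤s (s≤s z≤n))

coreWeight : ℕ → ℕ
coreWeight zero = 1
coreWeight (suc k) = k

WellWeighted : Profile → Set
WellWeighted p = coreWeight (length (blocks p)) ≤ weight p

-- Only meaningful for well-weighted profiles, since _∸_ truncates.
fromProfile : Profile → 𝒜
fromProfile p = pins (weight p ∸ coreWeight (length (blocks p))) (core (blocks p))

pins-cong : ∀ k → x ≈A y → pins k x ≈A pins k y
pins-cong zero x≈y = x≈y
pins-cong (suc k) x≈y = pin-cong (pins-cong k x≈y)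

core-cong : bs ≈LB cs → core bs ≈A core cs
core-cong [] = ≈A-refl
core-cong (_∷_ {xs = []} {ys = []} b≈c _) = b→a-cong b≈c
core-cong (_∷_ {xs = []} {ys = _ ∷ _} _ p) = ⊥-elim (↭.¬x∷xs↭[] (≈LB⇒↭ (≈LB-sym p)))
core-cong (_∷_ {xs = _ ∷ _} {ys = []} _ p) = ⊥-elim (↭.¬x∷xs↭[] (≈LB⇒↭ p))
core-cong (_∷_ {xs = _ ∷ _} {ys = _ ∷ _} b≈c p) = tri-cong (b≈c ∷ p)
core-cong swap = tri-cong swap
core-cong (trans p q) = ≈A-trans (core-cong p) (core-cong q)

fromProfile-cong : p ≈P q → fromProfile p ≈A fromProfile q
fromProfile-cong {L ∣ w} {L′ ∣ .w} (L≈L′ , refl) rewrite ≈LB-length L≈L′ = pins-cong _ (core-cong L≈L′)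

fromProfile-addArch : WellWeighted p → fromProfile (addArch p) ≡ pin (fromProfile p)
fromProfile-addArch {p} ww = cong (λ k → pins k (core (blocks p))) (+-∸-assoc 1 ww)

wellWeighted⇒length≤ : WellWeighted p → length (blocks p) ≤ suc (weight p)
wellWeighted⇒length≤ {[] ∣ _} _ = z≤n
wellWeighted⇒length≤ {_ ∷ _ ∣ _} ww = s≤s ww

coreWeight-≤ : ∀ {k w} → k ≤ 2 + w → coreWeight k ≤ suc w
coreWeight-≤ {zero} _ = s≤s z≤n
coreWeight-≤ {suc k} (s≤s k≤1+w) = k≤1+w

wellWeighted-addArch-⊕ : WellWeighted p → WellWeighted q → WellWeighted (addArch (p ⊕ q))
wellWeighted-addArch-⊕ {p} {q} wp wq = coreWeight-≤ (begin
  length (blocks p ++ blocks q)          ≡⟨ length-++ (blocks p) ⟩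
  length (blocks p) + length (blocks q)
    ≤⟨ +-mono-≤ (wellWeighted⇒length≤ {p} wp) (wellWeighted⇒length≤ {q} wq) ⟩
  suc (weight p) + suc (weight q)        ≡⟨ cong suc (+-suc (weight p) (weight q)) ⟩
  2 + (weight p + weight q)              ∎)
  where open Data.Nat.Properties.≤-Reasoning

sizeA-pins : ∀ k x → sizeA (pins k x) ≡ k + sizeA x
sizeA-pins zero x = refl
sizeA-pins (suc k) x = cong suc (sizeA-pins k x)

sizeA-core : ∀ bs → sizeA (core bs) ≡ coreWeight (length bs) + sizeLB bs
sizeA-core [] = refl
sizeA-core (b ∷ []) = ≡.sym (+-identityʳ (sizeB b))
sizeA-core (_ ∷ _ ∷ _) = refl

sizeA-fromProfile : WellWeighted p → sizeA (fromProfile p) ≡ profileSize p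
sizeA-fromProfile {L ∣ w} ww = begin
  sizeA (pins (w ∸ k) (core L))  ≡⟨ sizeA-pins (w ∸ k) (core L) ⟩
  (w ∸ k) + sizeA (core L)       ≡⟨ cong ((w ∸ k) +_) (sizeA-core L) ⟩
  (w ∸ k) + (k + sizeLB L)       ≡⟨ ≡.sym (+-assoc (w ∸ k) k (sizeLB L)) ⟩
  (w ∸ k) + k + sizeLB L         ≡⟨ cong (_+ sizeLB L) (m∸n+n≡m ww) ⟩
  w + sizeLB L                   ≡⟨ +-comm w (sizeLB L) ⟩
  sizeLB L + w                   ∎
  where
    open ≡-Reasoning
    k = coreWeight (length L)

enclose : Profile → List 𝒜 → Profile
enclose p xs with 3 ≤? length xs
... | yes long = node xs long ∷ [] ∣ 0
... | no _ = addArch p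

mutual
  profileA : Atom → Profile
  profileA ⟨ X ⟩ = enclose (profile X) (objectsOf X)

  profile : ArchSystem → Profile
  profile [] = ε
  profile (t ∷ X) = profileA t ⊕ profile X

  objectOf : Atom → 𝒜
  objectOf t = fromProfile (profileA t)

  objectsOf : ArchSystem → List 𝒜
  objectsOf [] = []
  objectsOf (t ∷ X) = objectOf t ∷ objectsOf X

private
  variable
    s t : Atom
    X Y S T : ArchSystem

length-objectsOf : ∀ X → length (objectsOf X) ≡ length X
length-objectsOf [] = refl
length-objectsOf (_ ∷ X) = cong suc (length-objectsOf X)

profile-atom : ∀ t → profile (atom t) ≡ profileA t
profile-atom t = ⊕-identityʳ (profileA t)

profile-++ : ∀ X Y → profile (X ++ Y) ≈P profile X ⊕ profile Y
profile-++ [] Y = ≈P-refl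
profile-++ (t ∷ X) Y =
  ≈P-trans (⊕-cong (≈P-refl {profileA t}) (profile-++ X Y)) (≈P-sym (⊕-assoc (profileA t) (profile X) (profile Y)))

enclose-short : length xs < 3 → enclose p xs ≡ addArch p
enclose-short {xs} short with 3 ≤? length xs
... | yes long = ⊥-elim (<⇒≱ short long)
... | no _ = refl

profileA-short : ∀ X → length X < 3 → profileA ⟨ X ⟩ ≡ addArch (profile X)
profileA-short X short = enclose-short (subst (_< 3) (≡.sym (length-objectsOf X)) short)

enclose-cong : p ≈P q → xs ≈LA ys → enclose p xs ≈P enclose q ys
enclose-cong {xs = xs} {ys} p≈q xs≈ys with 3 ≤? length xs | 3 ≤? length ys
... | yes _ | yes _ = node-cong xs≈ys ∷ [] , refl
... | no _ | no _ = addArch-cong p≈q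
... | yes long | no short = ⊥-elim (short (subst (3 ≤_) (≈LA-length xs≈ys) long))
... | no short | yes long = ⊥-elim (short (subst (3 ≤_) (≡.sym (≈LA-length xs≈ys)) long))

mutual
  wellWeighted-profileA : ∀ t → WellWeighted (profileA t)
  wellWeighted-profileA ⟨ X ⟩ with 3 ≤? length (objectsOf X)
  ... | yes _ = z≤n
  ... | no ¬long = coreWeight-≤ (≤-trans (length-blocks-profile X) (+-monoˡ-≤ _ X≤2))
    where
      X≤2 : length X ≤ 2
      X≤2 = ≤-pred (subst (_< 3) (length-objectsOf X) (≰⇒> ¬long))

  length-blocks-profile : ∀ X → length (blocks (profile X)) ≤ length X + weight (profile X)
  length-blocks-profile [] = z≤n
  length-blocks-profile (t ∷ X) = begin
    length (blocks (profileA t) ++ blocks (profile X))        ≡⟨ length-++ (blocks (profileA t)) ⟩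
    length (blocks (profileA t)) + length (blocks (profile X))
      ≤⟨ +-mono-≤ (wellWeighted⇒length≤ {profileA t} (wellWeighted-profileA t)) (length-blocks-profile X) ⟩
    suc (weight (profileA t)) + (length X + weight (profile X)) ≡⟨ shuffle (weight (profileA t)) (length X) _ ⟩
    suc (length X) + (weight (profileA t) + weight (profile X)) ∎
    where
      open Data.Nat.Properties.≤-Reasoning
      shuffle : ∀ a b c → suc a + (b + c) ≡ suc b + (a + c)
      shuffle = solve-∀

profileSize-enclose : ∀ p xs → sizeLA xs ≡ profileSize p → profileSize (enclose p xs) ≡ suc (profileSize p)
profileSize-enclose p xs e with 3 ≤? length xs
... | yes _ = ≡.trans (+-identityʳ _) (≡.trans (+-identityʳ _) (cong suc e))
... | no _ = profileSize-addArch p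

mutual
  profileSize-profileA : ∀ t → profileSize (profileA t) ≡ atomSize t
  profileSize-profileA ⟨ X ⟩ =
    ≡.trans (profileSize-enclose (profile X) (objectsOf X) (≡.trans (sizeLA-objectsOf X) (≡.sym (profileSize-profile X))))
            (cong suc (profileSize-profile X))

  profileSize-profile : ∀ X → profileSize (profile X) ≡ size X
  profileSize-profile [] = refl
  profileSize-profile (t ∷ X) =
    ≡.trans (profileSize-⊕ (profileA t) (profile X)) (cong₂ _+_ (profileSize-profileA t) (profileSize-profile X))

  sizeA-objectOf : ∀ t → sizeA (objectOf t) ≡ atomSize t
  sizeA-objectOf t = ≡.trans (sizeA-fromProfile {profileA t} (wellWeighted-profileA t)) (profileSize-profileA t)

  sizeLA-objectsOf : ∀ X → sizeLA (objectsOf X) ≡ size X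
  sizeLA-objectsOf [] = refl
  sizeLA-objectsOf (t ∷ X) = cong₂ _+_ (sizeA-objectOf t) (sizeLA-objectsOf X)

-- Invariance under ∼

size-++ : ∀ X Y → size (X ++ Y) ≡ size X + size Y
size-++ [] Y = refl
size-++ (t ∷ X) Y = ≡.trans (cong (atomSize t +_) (size-++ X Y)) (≡.sym (+-assoc (atomSize t) (size X) (size Y)))

size-++₄ : ∀ P X Y Q → size (P ++ X ++ Y ++ Q) ≡ size P + (size X + (size Y + size Q))
size-++₄ P X Y Q =
  ≡.trans (size-++ P _) (cong (size P +_) (≡.trans (size-++ X _) (cong (size X +_) (size-++ Y Q))))

size-resp-∼ : S ∼ T → size S ≡ size T
size-resp-∼ ∼-refl = refl
size-resp-∼ (∼-sym p) = ≡.sym (size-resp-∼ p)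
size-resp-∼ (∼-trans p q) = ≡.trans (size-resp-∼ p) (size-resp-∼ q)
size-resp-∼ (R1 p) = cong (λ n → suc n + 0) (size-resp-∼ p)
size-resp-∼ (R2 P Q {a} {b} p) =
  ≡.trans (size-++₄ P (sys a) [] Q)
    (≡.trans (cong (λ n → size P + (n + size Q)) (size-resp-∼ p)) (≡.sym (size-++₄ P (sys b) [] Q)))
size-resp-∼ (R3 P Q a b) =
  ≡.trans (size-++₄ P (sys a) (sys b) Q)
    (≡.trans (cong (size P +_) (left-comm (size (sys a)) (size (sys b)) (size Q)))
             (≡.sym (size-++₄ P (sys b) (sys a) Q)))
  where
    left-comm : ∀ m n o → m + (n + o) ≡ n + (m + o)
    left-comm = solve-∀
size-resp-∼ (R4 a b c) = begin
  size (sys a ++ atom ⟨ sys b ++ sys c ⟩)         ≡⟨ size-++ (sys a) _ ⟩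
  A + (suc (size (sys b ++ sys c)) + 0)           ≡⟨ cong (λ n → A + (suc n + 0)) (size-++ (sys b) (sys c)) ⟩
  A + (suc (B + C) + 0)                           ≡⟨ reassociate A B C ⟩
  suc (A + B) + 0 + C                             ≡⟨ cong (λ n → suc n + 0 + C) (size-++ (sys a) (sys b)) ⟨
  size (atom ⟨ sys a ++ sys b ⟩) + C              ≡⟨ size-++ (atom ⟨ sys a ++ sys b ⟩) (sys c) ⟨
  size (atom ⟨ sys a ++ sys b ⟩ ++ sys c)         ∎
  where
    open ≡-Reasoning
    A = size (sys a)
    B = size (sys b)
    C = size (sys c)
    reassociate : ∀ m n o → m + (suc (n + o) + 0) ≡ suc (m + n) + 0 + o
    reassociate = solve-∀

-- ∼ must preserve the profile of enclosed systems too, because of R1.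
record SameProfiles (S T : ArchSystem) : Set where
  constructor _,_
  field
    profile≈ : profile S ≈P profile T
    enclosed≈ : profileA ⟨ S ⟩ ≈P profileA ⟨ T ⟩

open SameProfiles

sameProfiles-refl : SameProfiles S S
sameProfiles-refl = ≈P-refl , ≈P-refl

sameProfiles-sym : SameProfiles S T → SameProfiles T S
sameProfiles-sym (e , e′) = ≈P-sym e , ≈P-sym e′

sameProfiles-trans : ∀ {U} → SameProfiles S T → SameProfiles T U → SameProfiles S U
sameProfiles-trans (e , e′) (f , f′) = ≈P-trans e f , ≈P-trans e′ f′

sameProfiles-atom : SameProfiles (atom s) (atom t) → profileA s ≈P profileA t
sameProfiles-atom {s} {t} e = subst₂ _≈P_ (profile-atom s) (profile-atom t) (profile≈ e)

profile-++ˡ-cong : ∀ P → profile X ≈P profile Y → profile (P ++ X) ≈P profile (P ++ Y)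
profile-++ˡ-cong [] e = e
profile-++ˡ-cong (t ∷ P) e = ⊕-cong (≈P-refl {profileA t}) (profile-++ˡ-cong P e)

objectsOf-++ˡ-cong : ∀ P → objectsOf X ≈LA objectsOf Y → objectsOf (P ++ X) ≈LA objectsOf (P ++ Y)
objectsOf-++ˡ-cong [] e = e
objectsOf-++ˡ-cong (_ ∷ P) e = ≈A-refl ∷ objectsOf-++ˡ-cong P e

sameProfiles-++ˡ : ∀ P → profile X ≈P profile Y → objectsOf X ≈LA objectsOf Y → SameProfiles (P ++ X) (P ++ Y)
sameProfiles-++ˡ P e objs = profile-++ˡ-cong P e , enclose-cong (profile-++ˡ-cong P e) (objectsOf-++ˡ-cong P objs)

sameProfiles-short : length S < 3 → length T < 3 → profile S ≈P profile T → SameProfiles S T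
sameProfiles-short {S} {T} S<3 T<3 e =
  e , subst₂ _≈P_ (≡.sym (profileA-short S S<3)) (≡.sym (profileA-short T T<3)) (addArch-cong e)

length-sys-++ : ∀ a b → length (sys a ++ sys b) < 3
length-sys-++ nothing nothing = s≤s z≤n
length-sys-++ nothing (just _) = s≤s (s≤s z≤n)
length-sys-++ (just _) nothing = s≤s (s≤s z≤n)
length-sys-++ (just _) (just _) = s≤s (s≤s (s≤s z≤n))

profile-R4 : ∀ a b c → profile (sys a ++ atom ⟨ sys b ++ sys c ⟩) ≈P profile (atom ⟨ sys a ++ sys b ⟩ ++ sys c)
profile-R4 a b c = begin
  profile (sys a ++ atom ⟨ sys b ++ sys c ⟩)  ≈⟨ profile-++ (sys a) _ ⟩
  A ⊕ profile (atom ⟨ sys b ++ sys c ⟩)       ≡⟨ cong (A ⊕_) (enclosed b c) ⟩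
  A ⊕ addArch (profile (sys b ++ sys c))      ≈⟨ ⊕-cong (≈P-refl {A}) (addArch-cong (profile-++ (sys b) (sys c))) ⟩
  A ⊕ addArch (B ⊕ C)                         ≡⟨ ⊕-addArchʳ A (B ⊕ C) ⟩
  addArch (A ⊕ (B ⊕ C))                       ≈⟨ addArch-cong (⊕-assoc A B C) ⟨
  addArch (A ⊕ B) ⊕ C                         ≈⟨ ⊕-cong (addArch-cong (profile-++ (sys a) (sys b))) (≈P-refl {C}) ⟨
  addArch (profile (sys a ++ sys b)) ⊕ C      ≡⟨ cong (_⊕ C) (enclosed a b) ⟨
  profile (atom ⟨ sys a ++ sys b ⟩) ⊕ C       ≈⟨ profile-++ (atom ⟨ sys a ++ sys b ⟩) (sys c) ⟨
  profile (atom ⟨ sys a ++ sys b ⟩ ++ sys c)  ∎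
  where
    open ≈P-Reasoning
    A = profile (sys a)
    B = profile (sys b)
    C = profile (sys c)
    enclosed : ∀ a b → profile (atom ⟨ sys a ++ sys b ⟩) ≡ addArch (profile (sys a ++ sys b))
    enclosed a b = ≡.trans (profile-atom _) (profileA-short (sys a ++ sys b) (length-sys-++ a b))

∼⇒sameProfiles : S ∼ T → SameProfiles S T
∼⇒sameProfiles ∼-refl = sameProfiles-refl
∼⇒sameProfiles (∼-sym p) = sameProfiles-sym (∼⇒sameProfiles p)
∼⇒sameProfiles (∼-trans p q) = sameProfiles-trans (∼⇒sameProfiles p) (∼⇒sameProfiles q)
∼⇒sameProfiles (R1 p) =
  sameProfiles-short (s≤s (s≤s z≤n)) (s≤s (s≤s z≤n)) (⊕-cong (enclosed≈ (∼⇒sameProfiles p)) ≈P-refl)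
∼⇒sameProfiles (R2 P Q {nothing} {nothing} _) = sameProfiles-refl
∼⇒sameProfiles (R2 P Q {nothing} {just ⟨ _ ⟩} p) = ⊥-elim (0≢1+n (size-resp-∼ p))
∼⇒sameProfiles (R2 P Q {just ⟨ _ ⟩} {nothing} p) = ⊥-elim (0≢1+n (≡.sym (size-resp-∼ p)))
∼⇒sameProfiles (R2 P Q {just s} {just t} p) =
  sameProfiles-++ˡ P (⊕-cong s≈t (≈P-refl {profile Q})) (fromProfile-cong s≈t ∷ ≈LA-refl)
  where
    s≈t : profileA s ≈P profileA t
    s≈t = sameProfiles-atom (∼⇒sameProfiles p)
∼⇒sameProfiles (R3 P Q nothing _) = sameProfiles-refl
∼⇒sameProfiles (R3 P Q (just _) nothing) = sameProfiles-refl
∼⇒sameProfiles (R3 P Q (just s) (just t)) =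
  sameProfiles-++ˡ P (⊕-left-comm (profileA s) (profileA t) (profile Q)) swap
∼⇒sameProfiles (R4 a b c) =
  sameProfiles-short (length-sys-++ a (just ⟨ sys b ++ sys c ⟩)) (length-sys-++ (just ⟨ sys a ++ sys b ⟩) c)
                     (profile-R4 a b c)

objectOf-resp-∼ : atom s ∼ atom t → objectOf s ≈A objectOf t
objectOf-resp-∼ p = fromProfile-cong (sameProfiles-atom (∼⇒sameProfiles p))

-- A representative atom for every object of 𝒜

mutual
  atomOf : 𝒜 → Atom
  atomOf dot = ⟨ [] ⟩
  atomOf (pin x) = ⟨ atomOf x ∷ [] ⟩
  atomOf (tri [] ())
  atomOf (tri (b ∷ bs) _) = comb b bs
  atomOf (b→a b) = atomOfB b

  atomOfB : ℬ → Atom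
  atomOfB (node xs _) = ⟨ atomsOf xs ⟩

  -- The comb ⟨b₁ ⟨b₂ … ⟨bₖ₋₁ bₖ⟩…⟩⟩: its k - 1 extra arches are the △ₖ₋₁.
  comb : ℬ → List ℬ → Atom
  comb b [] = atomOfB b
  comb b (c ∷ cs) = ⟨ atomOfB b ∷ comb c cs ∷ [] ⟩

  atomsOf : List 𝒜 → ArchSystem
  atomsOf [] = []
  atomsOf (x ∷ xs) = atomOf x ∷ atomsOf xs

combSystem : List ℬ → ArchSystem
combSystem [] = []
combSystem (b ∷ bs) = atom (comb b bs)

size-atom : ∀ t → size (atom t) ≡ atomSize t
size-atom t = +-identityʳ (atomSize t)

mutual
  atomSize-atomOf : ∀ x → atomSize (atomOf x) ≡ sizeA x
  atomSize-atomOf dot = refl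
  atomSize-atomOf (pin x) = cong suc (≡.trans (size-atom (atomOf x)) (atomSize-atomOf x))
  atomSize-atomOf (tri [] ())
  atomSize-atomOf (tri (b ∷ bs) _) = atomSize-comb b bs
  atomSize-atomOf (b→a b) = atomSize-atomOfB b

  atomSize-atomOfB : ∀ b → atomSize (atomOfB b) ≡ sizeB b
  atomSize-atomOfB (node xs _) = cong suc (size-atomsOf xs)

  atomSize-comb : ∀ b bs → atomSize (comb b bs) ≡ length bs + sizeLB (b ∷ bs)
  atomSize-comb b [] = ≡.trans (atomSize-atomOfB b) (≡.sym (+-identityʳ (sizeB b)))
  atomSize-comb b (c ∷ cs) =
    ≡.trans (cong₂ (λ m n → suc (m + (n + 0))) (atomSize-atomOfB b) (atomSize-comb c cs))
            (shuffle (sizeB b) (length cs) (sizeB c) (sizeLB cs))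
    where
      shuffle : ∀ m l n o → suc (m + ((l + (n + o)) + 0)) ≡ suc l + (m + (n + o))
      shuffle = solve-∀

  size-atomsOf : ∀ xs → size (atomsOf xs) ≡ sizeLA xs
  size-atomsOf [] = refl
  size-atomsOf (x ∷ xs) = cong₂ _+_ (atomSize-atomOf x) (size-atomsOf xs)

∼-setoid : Setoid 0ℓ 0ℓ
∼-setoid = record
  { Carrier = ArchSystem
  ; _≈_ = _∼_
  ; isEquivalence = record { refl = ∼-refl ; sym = ∼-sym ; trans = ∼-trans }
  }

module ∼-Reasoning = SetoidReasoning ∼-setoid

∼-∷-context : ∀ P {X Y} → atom s ∼ atom t → (P ++ atom t) ++ X ∼ (P ++ atom t) ++ Y → P ++ s ∷ X ∼ P ++ t ∷ Y
∼-∷-context {s} {t} P {X} {Y} s∼t X∼Y =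
  ∼-trans (R2 P X {just s} {just t} s∼t) (subst₂ _∼_ (++-assoc P (atom t) X) (++-assoc P (atom t) Y) X∼Y)

∼-pair : ∀ {s′ t′} → atom s ∼ atom s′ → atom t ∼ atom t′ → s ∷ t ∷ [] ∼ s′ ∷ t′ ∷ []
∼-pair {s} {t} {s′} {t′} s∼s′ t∼t′ =
  ∼-trans (R2 [] (atom t) {just s} {just s′} s∼s′) (R2 (atom s′) [] {just t} {just t′} t∼t′)

comb-swap : ∀ u v w → atom ⟨ u ∷ ⟨ v ∷ w ∷ [] ⟩ ∷ [] ⟩ ∼ atom ⟨ v ∷ ⟨ u ∷ w ∷ [] ⟩ ∷ [] ⟩
comb-swap u v w = R1 (begin
  u ∷ ⟨ v ∷ w ∷ [] ⟩ ∷ []  ≈⟨ R4 (just u) (just v) (just w) ⟩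
  ⟨ u ∷ v ∷ [] ⟩ ∷ w ∷ []
    ≈⟨ R2 [] (atom w) {just ⟨ u ∷ v ∷ [] ⟩} {just ⟨ v ∷ u ∷ [] ⟩} (R1 (R3 [] [] (just u) (just v))) ⟩
  ⟨ v ∷ u ∷ [] ⟩ ∷ w ∷ []  ≈⟨ R4 (just v) (just u) (just w) ⟨
  v ∷ ⟨ u ∷ w ∷ [] ⟩ ∷ []  ∎)
  where open ∼-Reasoning

mutual
  atomOf-cong : x ≈A y → atom (atomOf x) ∼ atom (atomOf y)
  atomOf-cong ≈A-refl = ∼-refl
  atomOf-cong (≈A-sym p) = ∼-sym (atomOf-cong p)
  atomOf-cong (≈A-trans p q) = ∼-trans (atomOf-cong p) (atomOf-cong q)
  atomOf-cong (pin-cong p) = R1 (atomOf-cong p)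
  atomOf-cong (tri-cong {[]} {_} {()} _)
  atomOf-cong (tri-cong {_ ∷ _} {[]} {_} {()} _)
  atomOf-cong (tri-cong {_ ∷ _} {_ ∷ _} p) = combSystem-cong p
  atomOf-cong (b→a-cong p) = atomOfB-cong p

  atomOfB-cong : b ≈B c → atom (atomOfB b) ∼ atom (atomOfB c)
  atomOfB-cong (node-cong p) = R1 (atomsOf-cong [] p)

  atomsOf-cong : ∀ P → xs ≈LA ys → P ++ atomsOf xs ∼ P ++ atomsOf ys
  atomsOf-cong P [] = ∼-refl
  atomsOf-cong P (p ∷ ps) = ∼-∷-context P (atomOf-cong p) (atomsOf-cong (P ++ atom _) ps)
  atomsOf-cong P (swap {x} {y} {xs}) = R3 P (atomsOf xs) (just (atomOf x)) (just (atomOf y))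
  atomsOf-cong P (trans p q) = ∼-trans (atomsOf-cong P p) (atomsOf-cong P q)

  combSystem-cong : bs ≈LB cs → combSystem bs ∼ combSystem cs
  combSystem-cong [] = ∼-refl
  combSystem-cong (_∷_ {xs = []} {ys = []} p _) = atomOfB-cong p
  combSystem-cong (_∷_ {xs = []} {ys = _ ∷ _} _ ps) = ⊥-elim (↭.¬x∷xs↭[] (≈LB⇒↭ (≈LB-sym ps)))
  combSystem-cong (_∷_ {xs = _ ∷ _} {ys = []} _ ps) = ⊥-elim (↭.¬x∷xs↭[] (≈LB⇒↭ ps))
  combSystem-cong (_∷_ {xs = _ ∷ _} {ys = _ ∷ _} p ps) = R1 (∼-pair (atomOfB-cong p) (combSystem-cong ps))
  combSystem-cong (swap {x} {y} {[]}) = R1 (R3 [] [] (just (atomOfB x)) (just (atomOfB y)))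
  combSystem-cong (swap {x} {y} {z ∷ zs}) = comb-swap (atomOfB x) (atomOfB y) (comb z zs)
  combSystem-cong (trans p q) = ∼-trans (combSystem-cong p) (combSystem-cong q)

nest : ℕ → Atom → Atom
nest zero t = t
nest (suc k) t = ⟨ nest k t ∷ [] ⟩

atomOf-pins : ∀ k x → atomOf (pins k x) ≡ nest k (atomOf x)
atomOf-pins zero x = refl
atomOf-pins (suc k) x = cong (λ t → ⟨ t ∷ [] ⟩) (atomOf-pins k x)

nest-+ : ∀ m n t → nest (m + n) t ≡ nest m (nest n t)
nest-+ zero n t = refl
nest-+ (suc m) n t = cong (λ u → ⟨ u ∷ [] ⟩) (nest-+ m n t)

nest-cong : ∀ k → atom s ∼ atom t → atom (nest k s) ∼ atom (nest k t)
nest-cong zero s∼t = s∼t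
nest-cong (suc k) s∼t = R1 (nest-cong k s∼t)

pair-nest : ∀ i j s t → atom ⟨ nest i s ∷ nest j t ∷ [] ⟩ ∼ atom (nest (i + j) ⟨ s ∷ t ∷ [] ⟩)
pair-nest zero zero s t = ∼-refl
pair-nest zero (suc j) s t = ∼-trans (R1 (R4 (just s) (just (nest j t)) nothing)) (R1 (pair-nest zero j s t))
pair-nest (suc i) j s t =
  ∼-trans (R1 (∼-sym (R4 nothing (just (nest i s)) (just (nest j t))))) (R1 (pair-nest i j s t))

comb-++ : ∀ b bs c cs → atom ⟨ comb b bs ∷ comb c cs ∷ [] ⟩ ∼ atom (comb b (bs ++ c ∷ cs))
comb-++ b [] c cs = ∼-refl
comb-++ b (b′ ∷ bs) c cs =
  ∼-trans (R1 (∼-sym (R4 (just (atomOfB b)) (just (comb b′ bs)) (just (comb c cs)))))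
          (R1 (R2 (atom (atomOfB b)) [] {just ⟨ comb b′ bs ∷ comb c cs ∷ [] ⟩}
                  {just (comb b′ (bs ++ c ∷ cs))} (comb-++ b′ bs c cs)))

pair-core : ∀ bs cs →
  ∃[ k ] (atom ⟨ atomOf (core bs) ∷ atomOf (core cs) ∷ [] ⟩ ∼ atom (nest k (atomOf (core (bs ++ cs)))))
pair-core [] cs = 2 , R1 (∼-sym (R4 nothing nothing (just (atomOf (core cs)))))
pair-core (b ∷ []) [] = 2 , R1 (R4 (just (atomOfB b)) nothing nothing)
pair-core (b ∷ []) (c ∷ []) = 0 , ∼-refl
pair-core (b ∷ []) (c ∷ c′ ∷ cs) = 0 , ∼-refl
pair-core (b ∷ b′ ∷ bs) [] rewrite ++-identityʳ bs = 2 , R1 (R4 (just (comb b (b′ ∷ bs))) nothing nothing)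
pair-core (b ∷ b′ ∷ bs) (c ∷ []) = 0 , comb-++ b (b′ ∷ bs) c []
pair-core (b ∷ b′ ∷ bs) (c ∷ c′ ∷ cs) = 0 , comb-++ b (b′ ∷ bs) c (c′ ∷ cs)

pins-size-injective : ∀ x {m n} → sizeA (pins m x) ≡ sizeA (pins n x) → m ≡ n
pins-size-injective x {m} {n} e =
  +-cancelʳ-≡ (sizeA x) m n (≡.trans (≡.sym (sizeA-pins m x)) (≡.trans e (sizeA-pins n x)))

size-pair : ∀ x y → size (atom ⟨ atomOf x ∷ atomOf y ∷ [] ⟩) ≡ suc (sizeA x + sizeA y)
size-pair x y =
  ≡.trans (size-atom ⟨ atomOf x ∷ atomOf y ∷ [] ⟩)
    (cong suc (cong₂ _+_ (atomSize-atomOf x) (≡.trans (size-atom (atomOf y)) (atomSize-atomOf y))))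

-- The number of pins is forced by the size, which ∼ preserves.
pair-fromProfile : ∀ p q → WellWeighted p → WellWeighted q →
  atom ⟨ atomOf (fromProfile p) ∷ atomOf (fromProfile q) ∷ [] ⟩ ∼ atom (atomOf (fromProfile (addArch (p ⊕ q))))
pair-fromProfile p q wp wq = subst (λ m → pair ∼ atom (atomOf (pins m joint))) pins≡ pair∼pins
  where
    L = blocks p
    L′ = blocks q
    i = weight p ∸ coreWeight (length L)
    j = weight q ∸ coreWeight (length L′)
    joint = core (L ++ L′)
    k = proj₁ (pair-core L L′)
    pair = atom ⟨ atomOf (fromProfile p) ∷ atomOf (fromProfile q) ∷ [] ⟩

    pair∼pins : pair ∼ atom (atomOf (pins (i + j + k) joint))
    pair∼pins = begin
      pair
        ≡⟨ cong₂ (λ s t → atom ⟨ s ∷ t ∷ [] ⟩) (atomOf-pins i (core L)) (atomOf-pins j (core L′)) ⟩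
      atom ⟨ nest i (atomOf (core L)) ∷ nest j (atomOf (core L′)) ∷ [] ⟩
        ≈⟨ pair-nest i j _ _ ⟩
      atom (nest (i + j) ⟨ atomOf (core L) ∷ atomOf (core L′) ∷ [] ⟩)
        ≈⟨ nest-cong (i + j) (proj₂ (pair-core L L′)) ⟩
      atom (nest (i + j) (nest k (atomOf joint)))
        ≡⟨ cong atom (nest-+ (i + j) k (atomOf joint)) ⟨
      atom (nest (i + j + k) (atomOf joint))
        ≡⟨ cong atom (atomOf-pins (i + j + k) joint) ⟨
      atom (atomOf (pins (i + j + k) joint))
        ∎
      where open ∼-Reasoning

    pins≡ : i + j + k ≡ weight (addArch (p ⊕ q)) ∸ coreWeight (length (L ++ L′))
    pins≡ = pins-size-injective joint (begin
      sizeA (pins (i + j + k) joint)                 ≡⟨ atomSize-atomOf (pins (i + j + k) joint) ⟨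
      atomSize (atomOf (pins (i + j + k) joint))     ≡⟨ size-atom _ ⟨
      size (atom (atomOf (pins (i + j + k) joint)))  ≡⟨ size-resp-∼ pair∼pins ⟨
      size pair                                      ≡⟨ size-pair (fromProfile p) (fromProfile q) ⟩
      suc (sizeA (fromProfile p) + sizeA (fromProfile q))
        ≡⟨ cong suc (cong₂ _+_ (sizeA-fromProfile {p} wp) (sizeA-fromProfile {q} wq)) ⟩
      suc (profileSize p + profileSize q)            ≡⟨ cong suc (profileSize-⊕ p q) ⟨
      suc (profileSize (p ⊕ q))                      ≡⟨ profileSize-addArch (p ⊕ q) ⟨
      profileSize (addArch (p ⊕ q))
        ≡⟨ sizeA-fromProfile {addArch (p ⊕ q)} (wellWeighted-addArch-⊕ {p} {q} wp wq) ⟨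
      sizeA (fromProfile (addArch (p ⊕ q)))          ∎)
      where open ≡-Reasoning

objectOf-single : ∀ t → objectOf ⟨ t ∷ [] ⟩ ≡ pin (objectOf t)
objectOf-single t =
  ≡.trans (cong (λ r → fromProfile (addArch r)) (⊕-identityʳ (profileA t)))
          (fromProfile-addArch {profileA t} (wellWeighted-profileA t))

objectOf-pair : ∀ s t → objectOf ⟨ s ∷ t ∷ [] ⟩ ≡ fromProfile (addArch (profileA s ⊕ profileA t))
objectOf-pair s t = cong (λ r → fromProfile (addArch (profileA s ⊕ r))) (⊕-identityʳ (profileA t))

mutual
  atom∼atomOf-objectOf : ∀ t → atom t ∼ atom (atomOf (objectOf t))
  atom∼atomOf-objectOf ⟨ [] ⟩ = ∼-refl
  atom∼atomOf-objectOf ⟨ s ∷ [] ⟩ = begin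
    atom ⟨ s ∷ [] ⟩                          ≈⟨ R1 (atom∼atomOf-objectOf s) ⟩
    atom (atomOf (pin (objectOf s)))         ≡⟨ cong (λ x → atom (atomOf x)) (objectOf-single s) ⟨
    atom (atomOf (objectOf ⟨ s ∷ [] ⟩))      ∎
    where open ∼-Reasoning
  atom∼atomOf-objectOf ⟨ s ∷ t ∷ [] ⟩ = begin
    atom ⟨ s ∷ t ∷ [] ⟩
      ≈⟨ R1 (∼-pair (atom∼atomOf-objectOf s) (atom∼atomOf-objectOf t)) ⟩
    atom ⟨ atomOf (objectOf s) ∷ atomOf (objectOf t) ∷ [] ⟩
      ≈⟨ pair-fromProfile (profileA s) (profileA t) (wellWeighted-profileA s) (wellWeighted-profileA t) ⟩
    atom (atomOf (fromProfile (addArch (profileA s ⊕ profileA t))))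
      ≡⟨ cong (λ x → atom (atomOf x)) (objectOf-pair s t) ⟨
    atom (atomOf (objectOf ⟨ s ∷ t ∷ [] ⟩))          ∎
    where open ∼-Reasoning
  atom∼atomOf-objectOf ⟨ X@(_ ∷ _ ∷ _ ∷ _) ⟩ = R1 (atomsOf-objectsOf [] X)

  atomsOf-objectsOf : ∀ P X → P ++ X ∼ P ++ atomsOf (objectsOf X)
  atomsOf-objectsOf P [] = ∼-refl
  atomsOf-objectsOf P (t ∷ X) = ∼-∷-context P (atom∼atomOf-objectOf t) (atomsOf-objectsOf (P ++ atom _) X)

≈A-reflexive : x ≡ y → x ≈A y
≈A-reflexive refl = ≈A-refl

mutual
  objectOf-atomOf : ∀ x → objectOf (atomOf x) ≈A x
  objectOf-atomOf dot = ≈A-refl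
  objectOf-atomOf (pin x) = ≈A-trans (≈A-reflexive (objectOf-single (atomOf x))) (pin-cong (objectOf-atomOf x))
  objectOf-atomOf (tri [] ())
  objectOf-atomOf (tri (_ ∷ []) (s≤s ()))
  objectOf-atomOf (tri (b ∷ b′ ∷ bs) _) =
    ≈A-trans (fromProfile-cong (profileA-comb b (b′ ∷ bs)))
             (≈A-trans (≈A-reflexive (cong (λ k → pins k (core (b ∷ b′ ∷ bs))) (n∸n≡0 (suc (length bs)))))
                       (tri-cong ≈LB-refl))
  objectOf-atomOf (b→a b) = fromProfile-cong (profileA-atomOfB b)

  objectsOf-atomsOf : ∀ xs → objectsOf (atomsOf xs) ≈LA xs
  objectsOf-atomsOf [] = []
  objectsOf-atomsOf (x ∷ xs) = objectOf-atomOf x ∷ objectsOf-atomsOf xs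

  profileA-atomOfB : ∀ b → profileA (atomOfB b) ≈P (b ∷ [] ∣ 0)
  profileA-atomOfB (node [] ())
  profileA-atomOfB (node (_ ∷ []) (s≤s ()))
  profileA-atomOfB (node (_ ∷ _ ∷ []) (s≤s (s≤s ())))
  profileA-atomOfB (node xs@(_ ∷ _ ∷ _ ∷ _) _) = node-cong (objectsOf-atomsOf xs) ∷ [] , refl

  profileA-comb : ∀ b bs → profileA (comb b bs) ≈P (b ∷ bs ∣ length bs)
  profileA-comb b [] = profileA-atomOfB b
  profileA-comb b (c ∷ cs) = begin
    profileA (comb b (c ∷ cs))
      ≡⟨ cong (λ r → addArch (profileA (atomOfB b) ⊕ r)) (⊕-identityʳ (profileA (comb c cs))) ⟩
    addArch (profileA (atomOfB b) ⊕ profileA (comb c cs))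
      ≈⟨ addArch-cong (⊕-cong (profileA-atomOfB b) (profileA-comb c cs)) ⟩
    (b ∷ c ∷ cs ∣ suc (length cs))                   ∎
    where open ≈P-Reasoning

objectOf-injective : objectOf s ≈A objectOf t → atom s ∼ atom t
objectOf-injective {s} {t} e =
  ∼-trans (atom∼atomOf-objectOf s) (∼-trans (atomOf-cong e) (∼-sym (atom∼atomOf-objectOf t)))

mainTheorem4 : (n : ℕ) → 1 ≤ n → Bijection (AtomicCohorts n) (𝒜-of-size n)
mainTheorem4 n _ = record
  { to = to
  ; cong = λ {S} {T} → to-cong {S} {T}
  ; bijective = (λ {S} {T} → to-injective {S} {T}) , to-surjective
  }
  where
    open Setoid (AtomicCohorts n) using () renaming (Carrier to Cohort; _≈_ to _≈C_)
    open Setoid (𝒜-of-size n) using () renaming (Carrier to Object; _≈_ to _≈O_)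

    representative : Cohort → Atom
    representative (_ , _ , t , _) = t

    representative∼ : ∀ S → atom (representative S) ∼ proj₁ S
    representative∼ (_ , _ , _ , t∼S) = t∼S

    to : Cohort → Object
    to (S , size≡n , t , t∼S) =
      objectOf t , ≡.trans (sizeA-objectOf t) (≡.trans (≡.sym (size-atom t)) (≡.trans (size-resp-∼ t∼S) size≡n))

    to-cong : ∀ {S T} → S ≈C T → to S ≈O to T
    to-cong {S} {T} S∼T = objectOf-resp-∼ (∼-trans (representative∼ S) (∼-trans S∼T (∼-sym (representative∼ T))))

    to-injective : ∀ {S T} → to S ≈O to T → S ≈C T
    to-injective {S} {T} e = ∼-trans (∼-sym (representative∼ S)) (∼-trans (objectOf-injective e) (representative∼ T))

    to-surjective : ∀ y → ∃[ S ] (∀ {T} → T ≈C S → to T ≈O y)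
    to-surjective (y , size≡n) =
      (atom (atomOf y) , ≡.trans (size-atom (atomOf y)) (≡.trans (atomSize-atomOf y) size≡n) , atomOf y , ∼-refl) ,
      λ {T} T∼S → ≈A-trans (objectOf-resp-∼ (∼-trans (representative∼ T) T∼S)) (objectOf-atomOf y)
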